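{- Let $L_1,L_2\in\mathcal{L}_n$. Then $L_1\preceq_B L_2$ if and only if $H(L_1)-H(L_2)$ is a sum of (finitely many) contiguous positive T-blocks. Moreover, if $L_1$ is obtained from $L_2$ by a single contiguous decreasing intercalate switch of consecutive integers, i.e. there are $i,j\in[n-1]$ and $a\in[n-1]$ such that $L_2$ has entries $a+1,a,a,a+1$ at positions $(i,j),(i,j+1),(i+1,j),(i+1,j+1)$ respectively, and $L_1$ is obtained from $L_2$ by replacing these entries by $a,a+1,a+1,a$, then $L_2$ covers $L_1$ in $(\mathcal{L}_n,\preceq_B)$.
   Context: $\mathcal{L}_n$ is the set of Latin squares of order $n$ on symbols $[n]$. For $L\in\mathcal{L}_n$, $H(L)$ is the $n\times n\times n$ $(0,1)$-hypermatrix with $H(L)_{i,j,k}=1$ iff $L_{i,j}=k$. A positive T-block is an $n\times n\times n$ integer hypermatrix $T$ for which there exist $i_1<i_2$, $j_1<j_2$, $k_1<k_2$ in $[n]$ such that $T$ is zero outside $\{i_1,i_2\}\times\{j_1,j_2\}\times\{k_1,k_2\}$, $T_{i_1,j_1,k_1}=T_{i_2,j_2,k_1}=1$, $T_{i_1,j_2,k_1}=T_{i_2,j_1,k_1}=-1$, $T_{i,j,k_2}=-T_{i,j,k_1}$; it is contiguous if $i_2=i_1+1$, $j_2=j_1+1$, $k_2=k_1+1$. $L_1\preceq_B L_2$ iff $H(L_1)-H(L_2)$ is a sum of finitely many positive T-blocks. $L_2$ covers $L_1$ means $L_1\preceq_B L_2$, $L_1\neq L_2$, and no $L'\in\mathcal{L}_n$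 distinct from both satisfies $L_1\preceq_B L'\preceq_B L_2$. -}

module Defs where

open import Data.Nat using (ℕ; suc)
open import Data.Fin using (Fin; toℕ; _<_)
open import Data.Integer using (ℤ; +_; -_; _+_; _-_)
open import Data.List using (List; foldr)
open import Data.List.Relation.Unary.All using (All)
open import Data.Product using (Σ; _×_; ∃-syntax)
open import Data.Sum using (_⊎_)
open import Function.Definitions using (Injective)
open import Relation.Binary.PropositionalEquality using (_≡_; _≢_)
open import Relation.Nullary using (¬_)

record Latin (n : ℕ) : Set where
  field
    entry  : Fin n → Fin n → Fin n
    rowInj : ∀ i → Injective _≡_ _≡_ (entry i)
    colInj : ∀ j → Injective _≡_ _≡_ (λ i → entry i j)
open Latin public

_≈L_ : ∀ {n} → Latin n → Latin n → Set
L₁ ≈L L₂ = ∀ i j → entry L₁ i j ≡ entry L₂ i j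

Hyper : ℕ → Set
Hyper n = Fin n → Fin n → Fin n → ℤ

_≈H_ : ∀ {n} → Hyper n → Hyper n → Set
A ≈H B = ∀ i j k → A i j k ≡ B i j k

zeroH : ∀ {n} → Hyper n
zeroH i j k = + 0

_+H_ : ∀ {n} → Hyper n → Hyper n → Hyper n
(A +H B) i j k = A i j k + B i j k

_-H_ : ∀ {n} → Hyper n → Hyper n → Hyper n
(A -H B) i j k = A i j k - B i j k

sumH : ∀ {n} → List (Hyper n) → Hyper n
sumH = foldr _+H_ zeroH

indicator : ∀ {n} → Fin n → Fin n → ℤ
indicator a b with Data.Fin._≟_ a b
... | Relation.Nullary.yes _ = + 1
... | Relation.Nullary.no  _ = + 0

H : ∀ {n} → Latin n → Hyper n
H L i j k = indicator (entry L i j) k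

IsPosTBlockAt : ∀ {n} → Hyper n → (i₁ i₂ j₁ j₂ k₁ k₂ : Fin n) → Set
IsPosTBlockAt T i₁ i₂ j₁ j₂ k₁ k₂ =
  (i₁ < i₂) × (j₁ < j₂) × (k₁ < k₂) ×
  (∀ i j k → ((i ≢ i₁ × i ≢ i₂) ⊎ (j ≢ j₁ × j ≢ j₂) ⊎ (k ≢ k₁ × k ≢ k₂))
           → T i j k ≡ + 0) ×
  (T i₁ j₁ k₁ ≡ + 1) × (T i₂ j₂ k₁ ≡ + 1) ×
  (T i₁ j₂ k₁ ≡ - + 1) × (T i₂ j₁ k₁ ≡ - + 1) ×
  (∀ i j → T i j k₂ ≡ - T i j k₁)

IsPosTBlock : ∀ {n} → Hyper n → Set
IsPosTBlock {n} T = ∃[ i₁ ] ∃[ i₂ ] ∃[ j₁ ] ∃[ j₂ ] ∃[ k₁ ] ∃[ k₂ ]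
  IsPosTBlockAt T i₁ i₂ j₁ j₂ k₁ k₂

IsContigPosTBlock : ∀ {n} → Hyper n → Set
IsContigPosTBlock {n} T = ∃[ i₁ ] ∃[ i₂ ] ∃[ j₁ ] ∃[ j₂ ] ∃[ k₁ ] ∃[ k₂ ]
  (IsPosTBlockAt T i₁ i₂ j₁ j₂ k₁ k₂ ×
   toℕ i₂ ≡ suc (toℕ i₁) × toℕ j₂ ≡ suc (toℕ j₁) × toℕ k₂ ≡ suc (toℕ k₁))

SumOf : ∀ {n} → (Hyper n → Set) → Hyper n → Set
SumOf {n} P A = Σ (List (Hyper n)) λ Ts → All P Ts × (A ≈H sumH Ts)

_⪯B_ : ∀ {n} → Latin n → Latin n → Set
L₁ ⪯B L₂ = SumOf IsPosTBlock (H L₁ -H H L₂)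

Covers : ∀ {n} → Latin n → Latin n → Set
Covers {n} L₂ L₁ =
  (L₁ ⪯B L₂) × ¬ (L₁ ≈L L₂) ×
  ¬ (Σ (Latin n) λ L′ → ¬ (L′ ≈L L₁) × ¬ (L′ ≈L L₂) × (L₁ ⪯B L′) × (L′ ⪯B L₂))

-- A positive T-block with corners i₁ < i₂, j₁ < j₂, k₁ < k₂ is the tensor
-- (e_i₁ − e_i₂) ⊗ (e_j₁ − e_j₂) ⊗ (e_k₁ − e_k₂). Each factor telescopes into differences of
-- consecutive unit vectors, so by trilinearity every positive T-block is a sum of contiguous ones.
--
-- For the covering statement, pair hypermatrices with ι ⊗ ι ⊗ ι, where ι t = t. The resulting
-- linear functional Φ equals (i₁ − i₂)(j₁ − j₂)(k₁ − k₂) ≤ −1 on a positive T-block, hence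
-- Φ (H L₁ − H L₂) ≤ −1 whenever L₁ ⪯B L₂ and L₁ ≠ L₂. A contiguous intercalate switch has Φ = −1
-- exactly, which leaves no room for a square strictly in between.
--
-- Neither argument uses that rows and columns of a Latin square are injective.

module Submission where

open import Defs
open import Data.Nat as ℕ using (ℕ; suc; z≤n; s≤s)
open import Data.Nat.Properties using (+-suc; m∸n+n≡m; m+n∸n≡m; m≤n+m; <⇒≤; ≤-reflexive)
open import Data.Fin as Fin using (Fin; toℕ; _≟_; inject₁)
open import Data.Fin.Properties using (<⇒≢; toℕ-inject₁)
open import Data.Fin.Induction using (<-weakInduction-startingFrom)
open import Data.Integer as ℤ
  using (ℤ; +_; -_; _+_; _-_; _*_; -[1+_]; 0ℤ; 1ℤ; -1ℤ; -≤-; -≤+)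
open import Data.Integer.Properties as ℤ
  using (+-inverseʳ; +-identityˡ; +-identityʳ; +-assoc; *-zeroʳ; *-identityˡ; *-distribˡ-+; *-distribʳ-+;
         -1*i≡-i; ⊖-<; +-mono-≤; +-*-semiring)
open import Data.Integer.Tactic.RingSolver using (solve-∀)
open import Algebra.Properties.Semiring.Sum +-*-semiring
  using (sum; sum-syntax; ∑-distrib-+; *-distribˡ-sum; *-distribʳ-sum; sum-cong-≗; sum-replicate-zero)
open import Data.Vec.Functional using (Vector)
open import Data.List using (List; []; _∷_; _++_)
open import Data.List.Relation.Unary.All as All using (All; []; _∷_)
open import Data.List.Relation.Unary.All.Properties using (++⁺)
open import Data.Product using (_×_; _,_; ∃-syntax)
open import Data.Sum using (_⊎_; inj₁; inj₂)
open import Function.Base using (_∘_)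
open import Function.Bundles using (_⇔_; mk⇔)
open import Relation.Nullary using (¬_; yes; no; contradiction)
open import Relation.Binary.PropositionalEquality

private variable
  n : ℕ
  p q r s a b : Fin n
  A B T : Hyper n
  Ts : List (Hyper n)

indicator-refl : (p : Fin n) → indicator p p ≡ 1ℤ
indicator-refl p with p ≟ p
... | yes _   = refl
... | no p≢p = contradiction refl p≢p

indicator-≢ : ∀ {t} → p ≢ t → indicator p t ≡ 0ℤ
indicator-≢ {p = p} {t = t} p≢t with p ≟ t
... | yes p≡t = contradiction p≡t p≢t
... | no _    = refl

indicator-suc : (p t : Fin n) → indicator (Fin.suc p) (Fin.suc t) ≡ indicator p t
indicator-suc p t with p ≟ t
... | yes _ = refl
... | no _  = refl

δ : Fin n → Fin n → Vector ℤ n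
δ p q t = indicator p t - indicator q t

δ-refl : (p t : Fin n) → δ p p t ≡ 0ℤ
δ-refl p t = +-inverseʳ (indicator p t)

δ-trans : (p q r t : Fin n) → δ p r t ≡ δ p q t + δ q r t
δ-trans p q r t = telescope (indicator p t) (indicator q t) (indicator r t)
  where
  telescope : ∀ x y z → x - z ≡ (x - y) + (y - z)
  telescope = solve-∀

δ-swap : (p q t : Fin n) → δ q p t ≡ -1ℤ * δ p q t
δ-swap p q t = swap (indicator p t) (indicator q t)
  where
  swap : ∀ x y → y - x ≡ -1ℤ * (x - y)
  swap = solve-∀

data Endpoint (p q : Fin n) : Fin n → Set where
  left  : Endpoint p q p
  right : Endpoint p q q
  off   : ∀ {t} → t ≢ p → t ≢ q → Endpoint p q t

endpoint : (p q t : Fin n) → Endpoint p q t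
endpoint p q t with t ≟ p | t ≟ q
... | yes refl | _        = left
... | no _     | yes refl = right
... | no t≢p   | no t≢q   = off t≢p t≢q

coefficient : ∀ {t} → Endpoint p q t → ℤ
coefficient left      = 1ℤ
coefficient right     = -1ℤ
coefficient (off _ _) = 0ℤ

δ-endpoint : ∀ {t} → p ≢ q → (e : Endpoint p q t) → δ p q t ≡ coefficient e
δ-endpoint {p = p} p≢q left  = cong₂ _-_ (indicator-refl p) (indicator-≢ (p≢q ∘ sym))
δ-endpoint {q = q} p≢q right = cong₂ _-_ (indicator-≢ p≢q) (indicator-refl q)
δ-endpoint _ (off t≢p t≢q)   = cong₂ _-_ (indicator-≢ (t≢p ∘ sym)) (indicator-≢ (t≢q ∘ sym))

δ-diagonal⇒≡ : δ p q p ≡ 0ℤ → p ≡ q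
δ-diagonal⇒≡ {p = p} {q = q} δ≡0 with p ≟ q
... | yes p≡q = p≡q
... | no p≢q  = contradiction (trans (sym (δ-endpoint p≢q left)) δ≡0) λ ()

negate-third : ∀ x y → x * y * -1ℤ ≡ - (x * y * 1ℤ)
negate-third = solve-∀

infix 25 _⊗_⊗_
_⊗_⊗_ : Vector ℤ n → Vector ℤ n → Vector ℤ n → Hyper n
(u ⊗ v ⊗ w) i j k = u i * v j * w k

δ⊗δ⊗δ-endpoint : ∀ {i j k} → p ≢ q → r ≢ s → a ≢ b →
  (eᵢ : Endpoint p q i) (eⱼ : Endpoint r s j) (eₖ : Endpoint a b k) →
  (δ p q ⊗ δ r s ⊗ δ a b) i j k ≡ coefficient eᵢ * coefficient eⱼ * coefficient eₖ
δ⊗δ⊗δ-endpoint p≢q r≢s a≢b eᵢ eⱼ eₖ =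
  cong₂ _*_ (cong₂ _*_ (δ-endpoint p≢q eᵢ) (δ-endpoint r≢s eⱼ)) (δ-endpoint a≢b eₖ)

δ⊗δ⊗δ-posTBlockAt : p Fin.< q → r Fin.< s → a Fin.< b →
  IsPosTBlockAt (δ p q ⊗ δ r s ⊗ δ a b) p q r s a b
δ⊗δ⊗δ-posTBlockAt {p = p} {q = q} {r = r} {s = s} {a = a} {b = b} p<q r<s a<b =
  p<q , r<s , a<b , vanishes ,
  value left left left , value right right left , value left right left , value right left left ,
  antisymmetric
  where
  p≢q = <⇒≢ p<q
  r≢s = <⇒≢ r<s
  a≢b = <⇒≢ a<b

  value : ∀ {i j k} (eᵢ : Endpoint p q i) (eⱼ : Endpoint r s j) (eₖ : Endpoint a b k) →
          (δ p q ⊗ δ r s ⊗ δ a b) i j k ≡ coefficient eᵢ * coefficient eⱼ * coefficient eₖ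
  value = δ⊗δ⊗δ-endpoint p≢q r≢s a≢b

  vanishes : ∀ i j k → (i ≢ p × i ≢ q) ⊎ (j ≢ r × j ≢ s) ⊎ (k ≢ a × k ≢ b) →
             (δ p q ⊗ δ r s ⊗ δ a b) i j k ≡ 0ℤ
  vanishes i j k (inj₁ (i≢p , i≢q)) =
    cong (λ x → x * δ r s j * δ a b k) (δ-endpoint p≢q (off i≢p i≢q))
  vanishes i j k (inj₂ (inj₁ (j≢r , j≢s))) = begin
    δ p q i * δ r s j * δ a b k ≡⟨ cong (λ y → δ p q i * y * δ a b k) (δ-endpoint r≢s (off j≢r j≢s)) ⟩
    δ p q i * 0ℤ * δ a b k      ≡⟨ cong (_* δ a b k) (*-zeroʳ (δ p q i)) ⟩
    0ℤ                          ∎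
    where open ≡-Reasoning
  vanishes i j k (inj₂ (inj₂ (k≢a , k≢b))) =
    trans (cong (δ p q i * δ r s j *_) (δ-endpoint a≢b (off k≢a k≢b))) (*-zeroʳ (δ p q i * δ r s j))

  antisymmetric : ∀ i j → (δ p q ⊗ δ r s ⊗ δ a b) i j b ≡ - (δ p q ⊗ δ r s ⊗ δ a b) i j a
  antisymmetric i j = begin
    x * y * δ a b b  ≡⟨ cong (x * y *_) (δ-endpoint a≢b right) ⟩
    x * y * -1ℤ      ≡⟨ negate-third x y ⟩
    - (x * y * 1ℤ)   ≡⟨ cong (λ z → - (x * y * z)) (δ-endpoint a≢b left) ⟨
    - (x * y * δ a b a) ∎
    where
    open ≡-Reasoning
    x = δ p q i
    y = δ r s j

posTBlockAt⇒δ⊗δ⊗δ : ∀ {i₁ i₂ j₁ j₂ k₁ k₂ : Fin n} → IsPosTBlockAt T i₁ i₂ j₁ j₂ k₁ k₂ →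
  T ≈H δ i₁ i₂ ⊗ δ j₁ j₂ ⊗ δ k₁ k₂
posTBlockAt⇒δ⊗δ⊗δ {T = T} {i₁ = i₁} {i₂} {j₁} {j₂} {k₁} {k₂}
  (i₁<i₂ , j₁<j₂ , k₁<k₂ , vanishes , T₁₁ , T₂₂ , T₁₂ , T₂₁ , antisymmetric) i j k =
  trans (entry-at eᵢ eⱼ eₖ) (sym (δ⊗δ⊗δ-endpoint (<⇒≢ i₁<i₂) (<⇒≢ j₁<j₂) (<⇒≢ k₁<k₂) eᵢ eⱼ eₖ))
  where
  eᵢ = endpoint i₁ i₂ i
  eⱼ = endpoint j₁ j₂ j
  eₖ = endpoint k₁ k₂ k

  layer : ∀ {i j} (eᵢ : Endpoint i₁ i₂ i) (eⱼ : Endpoint j₁ j₂ j) →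
          T i j k₁ ≡ coefficient eᵢ * coefficient eⱼ * 1ℤ
  layer left            left            = T₁₁
  layer left            right           = T₁₂
  layer right           left            = T₂₁
  layer right           right           = T₂₂
  layer (off i≢₁ i≢₂)   _               = vanishes _ _ _ (inj₁ (i≢₁ , i≢₂))
  layer left            (off j≢₁ j≢₂)   = vanishes _ _ _ (inj₂ (inj₁ (j≢₁ , j≢₂)))
  layer right           (off j≢₁ j≢₂)   = vanishes _ _ _ (inj₂ (inj₁ (j≢₁ , j≢₂)))

  entry-at : ∀ {i j k} (eᵢ : Endpoint i₁ i₂ i) (eⱼ : Endpoint j₁ j₂ j) (eₖ : Endpoint k₁ k₂ k) →
             T i j k ≡ coefficient eᵢ * coefficient eⱼ * coefficient eₖ
  entry-at eᵢ eⱼ left          = layer eᵢ eⱼ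
  entry-at eᵢ eⱼ right         =
    trans (antisymmetric _ _)
          (trans (cong -_ (layer eᵢ eⱼ)) (sym (negate-third (coefficient eᵢ) (coefficient eⱼ))))
  entry-at eᵢ eⱼ (off k≢₁ k≢₂) =
    trans (vanishes _ _ _ (inj₂ (inj₂ (k≢₁ , k≢₂)))) (sym (*-zeroʳ (coefficient eᵢ * coefficient eⱼ)))

sumH-++ : (Ts Us : List (Hyper n)) → sumH (Ts ++ Us) ≈H (sumH Ts +H sumH Us)
sumH-++ []       Us i j k = sym (+-identityˡ (sumH Us i j k))
sumH-++ (T ∷ Ts) Us i j k =
  trans (cong (_+_ (T i j k)) (sumH-++ Ts Us i j k)) (sym (+-assoc (T i j k) _ _))

module _ {P : Hyper n → Set} where

  SumOf-resp-≈H : A ≈H B → SumOf P B → SumOf P A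
  SumOf-resp-≈H A≈B (Ts , PTs , B≈ΣTs) = Ts , PTs , λ i j k → trans (A≈B i j k) (B≈ΣTs i j k)

  SumOf-zero : A ≈H zeroH → SumOf P A
  SumOf-zero A≈0 = [] , [] , A≈0

  SumOf-single : P A → SumOf P A
  SumOf-single {A = A} PA = A ∷ [] , PA ∷ [] , λ i j k → sym (+-identityʳ (A i j k))

  SumOf-+ : SumOf P A → SumOf P B → SumOf P (A +H B)
  SumOf-+ (Ts , PTs , A≈ΣTs) (Us , PUs , B≈ΣUs) =
    Ts ++ Us , ++⁺ PTs PUs ,
    λ i j k → trans (cong₂ _+_ (A≈ΣTs i j k) (B≈ΣUs i j k)) (sym (sumH-++ Ts Us i j k))

  SumOf-sumH : All (SumOf P) Ts → SumOf P (sumH Ts)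
  SumOf-sumH []           = SumOf-zero λ _ _ _ → refl
  SumOf-sumH (ΣT ∷ ΣTs)   = SumOf-+ ΣT (SumOf-sumH ΣTs)

  SumOf-join : SumOf (SumOf P) A → SumOf P A
  SumOf-join (Ts , ΣTs , A≈ΣTs) = SumOf-resp-≈H A≈ΣTs (SumOf-sumH ΣTs)

SumOf-map : {P Q : Hyper n → Set} → (∀ {T} → P T → Q T) → SumOf P A → SumOf Q A
SumOf-map P⇒Q (Ts , PTs , A≈ΣTs) = Ts , All.map P⇒Q PTs , A≈ΣTs

record δ-Additive (F : Vector ℤ n → Hyper n) : Set where
  field
    diagonal  : ∀ p → F (δ p p) ≈H zeroH
    telescope : ∀ p q r → F (δ p r) ≈H (F (δ p q) +H F (δ q r))

SumOf-δ-telescope : {P : Hyper (suc n) → Set} {F : Vector ℤ (suc n) → Hyper (suc n)} → δ-Additive F →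
  (∀ j → SumOf P (F (δ (inject₁ j) (Fin.suc j)))) → p Fin.≤ q → SumOf P (F (δ p q))
SumOf-δ-telescope {p = p} {P = P} {F} additive step =
  <-weakInduction-startingFrom (λ q → SumOf P (F (δ p q))) (SumOf-zero (diagonal p))
    λ j ΣF → SumOf-resp-≈H (telescope p (inject₁ j) (Fin.suc j)) (SumOf-+ ΣF (step j))
  where open δ-Additive additive

⊗-additive₁ : (v w : Vector ℤ n) → δ-Additive (λ u → u ⊗ v ⊗ w)
⊗-additive₁ v w = record
  { diagonal  = λ p i j k → cong (λ x → x * v j * w k) (δ-refl p i)
  ; telescope = λ p q r i j k →
      trans (cong (λ x → x * v j * w k) (δ-trans p q r i))
            (trans (cong (_* w k) (*-distribʳ-+ (v j) (δ p q i) (δ q r i)))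
                   (*-distribʳ-+ (w k) (δ p q i * v j) (δ q r i * v j)))
  }

⊗-additive₂ : (u w : Vector ℤ n) → δ-Additive (λ v → u ⊗ v ⊗ w)
⊗-additive₂ u w = record
  { diagonal  = λ p i j k → trans (cong (λ y → u i * y * w k) (δ-refl p j)) (cong (_* w k) (*-zeroʳ (u i)))
  ; telescope = λ p q r i j k →
      trans (cong (λ y → u i * y * w k) (δ-trans p q r j))
            (trans (cong (_* w k) (*-distribˡ-+ (u i) (δ p q j) (δ q r j)))
                   (*-distribʳ-+ (w k) (u i * δ p q j) (u i * δ q r j)))
  }

⊗-additive₃ : (u v : Vector ℤ n) → δ-Additive (λ w → u ⊗ v ⊗ w)
⊗-additive₃ u v = record
  { diagonal  = λ p i j k → trans (cong (u i * v j *_) (δ-refl p k)) (*-zeroʳ (u i * v j))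
  ; telescope = λ p q r i j k →
      trans (cong (u i * v j *_) (δ-trans p q r k)) (*-distribˡ-+ (u i * v j) (δ p q k) (δ q r k))
  }

adjacent⇒< : toℕ q ≡ suc (toℕ p) → p Fin.< q
adjacent⇒< q≡1+p = ≤-reflexive (sym q≡1+p)

δ⊗δ⊗δ-contig : toℕ q ≡ suc (toℕ p) → toℕ s ≡ suc (toℕ r) → toℕ b ≡ suc (toℕ a) →
  IsContigPosTBlock (δ p q ⊗ δ r s ⊗ δ a b)
δ⊗δ⊗δ-contig {q = q} {p = p} {s = s} {r = r} {b = b} {a = a} q≡1+p s≡1+r b≡1+a =
  p , q , r , s , a , b ,
  δ⊗δ⊗δ-posTBlockAt (adjacent⇒< q≡1+p) (adjacent⇒< s≡1+r) (adjacent⇒< b≡1+a) ,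
  q≡1+p , s≡1+r , b≡1+a

δ⊗δ⊗δ-SumOf-contig : ∀ {n} {p q r s a b : Fin n} → p Fin.≤ q → r Fin.≤ s → a Fin.≤ b →
  SumOf IsContigPosTBlock (δ p q ⊗ δ r s ⊗ δ a b)
δ⊗δ⊗δ-SumOf-contig {suc n} {r = r} {s = s} {a = a} {b = b} p≤q r≤s a≤b =
  SumOf-δ-telescope (⊗-additive₁ (δ r s) (δ a b))
    (λ i → SumOf-δ-telescope (⊗-additive₂ (step i) (δ a b))
      (λ j → SumOf-δ-telescope (⊗-additive₃ (step i) (step j))
        (λ k → SumOf-single (δ⊗δ⊗δ-contig (adjacent i) (adjacent j) (adjacent k)))
        a≤b)
      r≤s)
    p≤q
  where
  step : Fin n → Vector ℤ (suc n)
  step i = δ (inject₁ i) (Fin.suc i)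
  adjacent : (i : Fin n) → toℕ (Fin.suc i) ≡ suc (toℕ (inject₁ i))
  adjacent i = cong suc (sym (toℕ-inject₁ i))

posTBlock⇒SumOf-contig : IsPosTBlock T → SumOf IsContigPosTBlock T
posTBlock⇒SumOf-contig (i₁ , i₂ , j₁ , j₂ , k₁ , k₂ , block@(i₁<i₂ , j₁<j₂ , k₁<k₂ , _)) =
  SumOf-resp-≈H (posTBlockAt⇒δ⊗δ⊗δ block) (δ⊗δ⊗δ-SumOf-contig (<⇒≤ i₁<i₂) (<⇒≤ j₁<j₂) (<⇒≤ k₁<k₂))

contig⇒posTBlock : IsContigPosTBlock T → IsPosTBlock T
contig⇒posTBlock (i₁ , i₂ , j₁ , j₂ , k₁ , k₂ , block , _) = i₁ , i₂ , j₁ , j₂ , k₁ , k₂ , block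

SumOf-posTBlock⇔SumOf-contig : SumOf IsPosTBlock A ⇔ SumOf IsContigPosTBlock A
SumOf-posTBlock⇔SumOf-contig =
  mk⇔ (SumOf-join ∘ SumOf-map posTBlock⇒SumOf-contig) (SumOf-map contig⇒posTBlock)

infix 8 _·_
_·_ : Vector ℤ n → Vector ℤ n → ℤ
_·_ {n} u x = ∑[ t < n ] (u t * x t)

⟪_,_⟫ : Hyper n → Hyper n → ℤ
⟪_,_⟫ {n} A B = ∑[ i < n ] ∑[ j < n ] ∑[ k < n ] (A i j k * B i j k)

⟪⟫-congˡ : {A A′ : Hyper n} → A ≈H A′ → ⟪ A , B ⟫ ≡ ⟪ A′ , B ⟫
⟪⟫-congˡ {B = B} A≈A′ =
  sum-cong-≗ λ i → sum-cong-≗ λ j → sum-cong-≗ λ k → cong (_* B i j k) (A≈A′ i j k)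

sum-zero : {f : Vector ℤ n} → (∀ t → f t ≡ 0ℤ) → sum f ≡ 0ℤ
sum-zero {n} f≗0 = trans (sum-cong-≗ f≗0) (sum-replicate-zero n)

⟪⟫-zeroˡ : (B : Hyper n) → ⟪ zeroH , B ⟫ ≡ 0ℤ
⟪⟫-zeroˡ {n} B = sum-zero {n} λ i → sum-zero {n} λ j → sum-zero {n} λ k → refl

⟪⟫-distribʳ-+H : (A A′ B : Hyper n) → ⟪ A +H A′ , B ⟫ ≡ ⟪ A , B ⟫ + ⟪ A′ , B ⟫
⟪⟫-distribʳ-+H A A′ B =
  trans (sum-cong-≗ λ i →
    trans (sum-cong-≗ λ j →
      trans (sum-cong-≗ λ k → *-distribʳ-+ (B i j k) (A i j k) (A′ i j k))
            (∑-distrib-+ (AB i j) (A′B i j)))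
    (∑-distrib-+ (λ j → sum (AB i j)) (λ j → sum (A′B i j))))
  (∑-distrib-+ (λ i → sum λ j → sum (AB i j)) (λ i → sum λ j → sum (A′B i j)))
  where
  AB A′B : Hyper _
  AB  i j k = A i j k * B i j k
  A′B i j k = A′ i j k * B i j k

⟪⊗,⊗⟫ : (u v w x y z : Vector ℤ n) → ⟪ u ⊗ v ⊗ w , x ⊗ y ⊗ z ⟫ ≡ (u · x) * (v · y) * (w · z)
⟪⊗,⊗⟫ {n} u v w x y z = begin
  ⟪ u ⊗ v ⊗ w , x ⊗ y ⊗ z ⟫
    ≡⟨ sum-cong-≗ (λ i → sum-cong-≗ λ j → sum-cong-≗ λ k → regroup (u i) (v j) (w k) (x i) (y j) (z k)) ⟩
  ∑[ i < n ] ∑[ j < n ] ∑[ k < n ] ((u i * x i) * (v j * y j) * (w k * z k))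
    ≡⟨ sum-cong-≗ (λ i → sum-cong-≗ λ j → *-distribˡ-sum (u i * x i * (v j * y j)) (λ k → w k * z k)) ⟨
  ∑[ i < n ] ∑[ j < n ] ((u i * x i) * (v j * y j) * (w · z))
    ≡⟨ sum-cong-≗ (λ i → *-distribʳ-sum (w · z) (λ j → u i * x i * (v j * y j))) ⟨
  ∑[ i < n ] ((∑[ j < n ] ((u i * x i) * (v j * y j))) * (w · z))
    ≡⟨ sum-cong-≗ (λ i → cong (_* (w · z)) (*-distribˡ-sum (u i * x i) (λ j → v j * y j))) ⟨
  ∑[ i < n ] ((u i * x i) * (v · y) * (w · z))
    ≡⟨ *-distribʳ-sum (w · z) (λ i → u i * x i * (v · y)) ⟨
  (∑[ i < n ] ((u i * x i) * (v · y))) * (w · z)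
    ≡⟨ cong (_* (w · z)) (*-distribʳ-sum (v · y) (λ i → u i * x i)) ⟨
  (u · x) * (v · y) * (w · z) ∎
  where
  open ≡-Reasoning
  regroup : ∀ a b c d e f → a * b * c * (d * e * f) ≡ (a * d) * (b * e) * (c * f)
  regroup = solve-∀

indicator-· : (p : Fin n) (x : Vector ℤ n) → indicator p · x ≡ x p
indicator-· {suc n} Fin.zero x =
  trans (cong₂ _+_ (*-identityˡ (x Fin.zero)) (sum-replicate-zero n)) (+-identityʳ (x Fin.zero))
indicator-· {suc n} (Fin.suc p) x =
  trans (+-identityˡ _)
        (trans (sum-cong-≗ λ t → cong (_* x (Fin.suc t)) (indicator-suc p t))
               (indicator-· p (x ∘ Fin.suc)))

δ-· : (p q : Fin n) (x : Vector ℤ n) → δ p q · x ≡ x p - x q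
δ-· {n} p q x = begin
  δ p q · x
    ≡⟨ sum-cong-≗ (λ t → split (indicator p t) (indicator q t) (x t)) ⟩
  ∑[ t < n ] (indicator p t * x t + -1ℤ * (indicator q t * x t))
    ≡⟨ ∑-distrib-+ (λ t → indicator p t * x t) (λ t → -1ℤ * (indicator q t * x t)) ⟩
  indicator p · x + ∑[ t < n ] (-1ℤ * (indicator q t * x t))
    ≡⟨ cong (_+_ (indicator p · x)) (*-distribˡ-sum -1ℤ (λ t → indicator q t * x t)) ⟨
  indicator p · x + -1ℤ * (indicator q · x)
    ≡⟨ cong₂ (λ y z → y + -1ℤ * z) (indicator-· p x) (indicator-· q x) ⟩
  x p + -1ℤ * x q
    ≡⟨ cong (_+_ (x p)) (-1*i≡-i (x q)) ⟩
  x p - x q ∎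
  where
  open ≡-Reasoning
  split : ∀ a b c → (a - b) * c ≡ a * c + -1ℤ * (b * c)
  split = solve-∀

ι : Vector ℤ n
ι t = + toℕ t

Φ : Hyper n → ℤ
Φ A = ⟪ A , ι ⊗ ι ⊗ ι ⟫

ι-gap : ∀ {k} → toℕ q ≡ suc (k ℕ.+ toℕ p) → ι p - ι q ≡ -[1+ k ]
ι-gap {p = p} {k = k} q≡1+k+p rewrite q≡1+k+p =
  trans (⊖-< (s≤s (m≤n+m (toℕ p) k))) (cong (-_ ∘ +_) (m+n∸n≡m (suc k) (toℕ p)))

<⇒gap : p Fin.< q → ∃[ k ] toℕ q ≡ suc (k ℕ.+ toℕ p)
<⇒gap {p = p} p<q = _ , sym (trans (sym (+-suc _ (toℕ p))) (m∸n+n≡m p<q))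

Φ-δ⊗δ⊗δ : ∀ {x y z} (p q r s a b : Fin n) →
  toℕ q ≡ suc (x ℕ.+ toℕ p) → toℕ s ≡ suc (y ℕ.+ toℕ r) → toℕ b ≡ suc (z ℕ.+ toℕ a) →
  Φ (δ p q ⊗ δ r s ⊗ δ a b) ≡ -[1+ x ] * -[1+ y ] * -[1+ z ]
Φ-δ⊗δ⊗δ {x = x} {y} {z} p q r s a b q-gap s-gap b-gap = begin
  Φ (δ p q ⊗ δ r s ⊗ δ a b)                     ≡⟨ ⟪⊗,⊗⟫ (δ p q) (δ r s) (δ a b) ι ι ι ⟩
  (δ p q · ι) * (δ r s · ι) * (δ a b · ι)       ≡⟨ cong₂ _*_ (cong₂ _*_ (δ-· p q ι) (δ-· r s ι)) (δ-· a b ι) ⟩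
  (ι p - ι q) * (ι r - ι s) * (ι a - ι b)       ≡⟨ cong₂ _*_ (cong₂ _*_ (ι-gap q-gap) (ι-gap s-gap)) (ι-gap b-gap) ⟩
  -[1+ x ] * -[1+ y ] * -[1+ z ]                ∎
  where open ≡-Reasoning

Φ-posTBlock : IsPosTBlock T → Φ T ℤ.≤ -1ℤ
Φ-posTBlock {T = T} (i₁ , i₂ , j₁ , j₂ , k₁ , k₂ , block@(i₁<i₂ , j₁<j₂ , k₁<k₂ , _))
  with <⇒gap i₁<i₂ | <⇒gap j₁<j₂ | <⇒gap k₁<k₂
... | x , i-gap | y , j-gap | z , k-gap = begin
  Φ T                                  ≡⟨ ⟪⟫-congˡ (posTBlockAt⇒δ⊗δ⊗δ block) ⟩
  Φ (δ i₁ i₂ ⊗ δ j₁ j₂ ⊗ δ k₁ k₂)      ≡⟨ Φ-δ⊗δ⊗δ i₁ i₂ j₁ j₂ k₁ k₂ i-gap j-gap k-gap ⟩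
  -[1+ x ] * -[1+ y ] * -[1+ z ]       ≤⟨ -≤- z≤n ⟩  -- the product computes to some -[1+ _ ]
  -1ℤ                                  ∎
  where open ℤ.≤-Reasoning

Φ-sumH-negative : All IsPosTBlock (T ∷ Ts) → Φ (sumH (T ∷ Ts)) ℤ.≤ -1ℤ
Φ-sumH-nonpositive : All IsPosTBlock Ts → Φ (sumH Ts) ℤ.≤ 0ℤ

Φ-sumH-negative {T = T} {Ts = Ts} (PT ∷ PTs) = begin
  Φ (T +H sumH Ts)       ≡⟨ ⟪⟫-distribʳ-+H T (sumH Ts) (ι ⊗ ι ⊗ ι) ⟩
  Φ T + Φ (sumH Ts)      ≤⟨ +-mono-≤ (Φ-posTBlock PT) (Φ-sumH-nonpositive PTs) ⟩
  -1ℤ + 0ℤ               ∎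
  where open ℤ.≤-Reasoning

Φ-sumH-nonpositive {n} []     = ℤ.≤-reflexive (⟪⟫-zeroˡ {n} (ι ⊗ ι ⊗ ι))
Φ-sumH-nonpositive (PT ∷ PTs) = ℤ.≤-trans (Φ-sumH-negative (PT ∷ PTs)) -≤+

≈L⇒H-difference-zero : (L₁ L₂ : Latin n) → L₁ ≈L L₂ → (H L₁ -H H L₂) ≈H zeroH
≈L⇒H-difference-zero L₁ L₂ L₁≈L₂ i j k =
  trans (cong (λ x → δ x (entry L₂ i j) k) (L₁≈L₂ i j)) (δ-refl (entry L₂ i j) k)

H-difference-zero⇒≈L : (L₁ L₂ : Latin n) → (H L₁ -H H L₂) ≈H zeroH → L₁ ≈L L₂
H-difference-zero⇒≈L L₁ L₂ D≈0 i j = δ-diagonal⇒≡ (D≈0 i j (entry L₁ i j))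

⪯B-strict⇒Φ≤-1 : (L₁ L₂ : Latin n) → L₁ ⪯B L₂ → ¬ L₁ ≈L L₂ → Φ (H L₁ -H H L₂) ℤ.≤ -1ℤ
⪯B-strict⇒Φ≤-1 L₁ L₂ ([]    , _   , D≈0)   L₁≉L₂ = contradiction (H-difference-zero⇒≈L L₁ L₂ D≈0) L₁≉L₂
⪯B-strict⇒Φ≤-1 L₁ L₂ (_ ∷ _ , PTs , D≈ΣTs) _     =
  subst (ℤ._≤ -1ℤ) (sym (⟪⟫-congˡ D≈ΣTs)) (Φ-sumH-negative PTs)

Φ≡-1⇒Covers : (L₁ L₂ : Latin n) → L₁ ⪯B L₂ → Φ (H L₁ -H H L₂) ≡ -1ℤ → Covers L₂ L₁
Φ≡-1⇒Covers {n} L₁ L₂ L₁⪯L₂ Φ≡-1 = L₁⪯L₂ , L₁≉L₂ , nothing-between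
  where
  L₁≉L₂ : ¬ L₁ ≈L L₂
  L₁≉L₂ L₁≈L₂ = contradiction Φ≡0 λ ()
    where
    open ≡-Reasoning
    Φ≡0 : -1ℤ ≡ 0ℤ
    Φ≡0 = begin
      -1ℤ               ≡⟨ Φ≡-1 ⟨
      Φ (H L₁ -H H L₂)  ≡⟨ ⟪⟫-congˡ (≈L⇒H-difference-zero L₁ L₂ L₁≈L₂) ⟩
      Φ (zeroH {n})     ≡⟨ ⟪⟫-zeroˡ {n} (ι ⊗ ι ⊗ ι) ⟩
      0ℤ                ∎

  nothing-between : ¬ (∃[ L ] ¬ L ≈L L₁ × ¬ L ≈L L₂ × L₁ ⪯B L × L ⪯B L₂)
  nothing-between (L , L≉L₁ , L≉L₂ , L₁⪯L , L⪯L₂) =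
    -1≰-2 (subst (ℤ._≤ -[1+ 1 ]) Φ-split
                 (+-mono-≤ (⪯B-strict⇒Φ≤-1 L₁ L L₁⪯L (L≉L₁ ∘ ≈L-sym)) (⪯B-strict⇒Φ≤-1 L L₂ L⪯L₂ L≉L₂)))
    where
    -1≰-2 : ¬ -1ℤ ℤ.≤ -[1+ 1 ]
    -1≰-2 (-≤- ())
    ≈L-sym : L₁ ≈L L → L ≈L L₁
    ≈L-sym L₁≈L i j = sym (L₁≈L i j)
    Φ-split : Φ (H L₁ -H H L) + Φ (H L -H H L₂) ≡ -1ℤ
    Φ-split = begin
      Φ (H L₁ -H H L) + Φ (H L -H H L₂)    ≡⟨ ⟪⟫-distribʳ-+H (H L₁ -H H L) (H L -H H L₂) (ι ⊗ ι ⊗ ι) ⟨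
      Φ ((H L₁ -H H L) +H (H L -H H L₂))   ≡⟨ ⟪⟫-congˡ (λ i j k → δ-trans (entry L₁ i j) (entry L i j) (entry L₂ i j) k) ⟨
      Φ (H L₁ -H H L₂)                     ≡⟨ Φ≡-1 ⟩
      -1ℤ                                  ∎
      where open ≡-Reasoning

intercalate-difference : (L₁ L₂ : Latin n) {i i′ j j′ a a′ : Fin n} → i ≢ i′ → j ≢ j′ →
  entry L₂ i j ≡ a′ → entry L₂ i j′ ≡ a → entry L₂ i′ j ≡ a → entry L₂ i′ j′ ≡ a′ →
  entry L₁ i j ≡ a → entry L₁ i j′ ≡ a′ → entry L₁ i′ j ≡ a′ → entry L₁ i′ j′ ≡ a →
  (∀ r c → (r ≢ i × r ≢ i′) ⊎ (c ≢ j × c ≢ j′) → entry L₁ r c ≡ entry L₂ r c) →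
  (H L₁ -H H L₂) ≈H δ i i′ ⊗ δ j j′ ⊗ δ a a′
intercalate-difference L₁ L₂ {i} {i′} {j} {j′} {a} {a′} i≢i′ j≢j′
  L₂ij L₂ij′ L₂i′j L₂i′j′ L₁ij L₁ij′ L₁i′j L₁i′j′ elsewhere r c k =
  trans (at (endpoint i i′ r) (endpoint j j′ c))
        (sym (cong₂ (λ x y → x * y * δ a a′ k) (δ-endpoint i≢i′ (endpoint i i′ r))
                                                (δ-endpoint j≢j′ (endpoint j j′ c))))
  where
  switched : ∀ {r c x y} → entry L₁ r c ≡ x → entry L₂ r c ≡ y →
             δ (entry L₁ r c) (entry L₂ r c) k ≡ δ x y k
  switched = cong₂ (λ x y → δ x y k)

  unchanged : ∀ r c → (r ≢ i × r ≢ i′) ⊎ (c ≢ j × c ≢ j′) → δ (entry L₁ r c) (entry L₂ r c) k ≡ 0ℤ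
  unchanged r c outside =
    trans (cong (λ x → δ x (entry L₂ r c) k) (elsewhere r c outside)) (δ-refl (entry L₂ r c) k)

  at : ∀ {r c} (eᵣ : Endpoint i i′ r) (e꜀ : Endpoint j j′ c) →
       δ (entry L₁ r c) (entry L₂ r c) k ≡ coefficient eᵣ * coefficient e꜀ * δ a a′ k
  at left  left  = trans (switched L₁ij L₂ij) (sym (*-identityˡ (δ a a′ k)))
  at left  right = trans (switched L₁ij′ L₂ij′) (δ-swap a a′ k)
  at right left  = trans (switched L₁i′j L₂i′j) (δ-swap a a′ k)
  at right right = trans (switched L₁i′j′ L₂i′j′) (sym (*-identityˡ (δ a a′ k)))
  at (off r≢i r≢i′) _ = unchanged _ _ (inj₁ (r≢i , r≢i′))
  at left  (off c≢j c≢j′) = unchanged _ _ (inj₂ (c≢j , c≢j′))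
  at right (off c≢j c≢j′) = unchanged _ _ (inj₂ (c≢j , c≢j′))

mainTheorem14 : (n : ℕ) (L₁ L₂ : Latin n) →
    ((L₁ ⪯B L₂) ⇔ SumOf IsContigPosTBlock (H L₁ -H H L₂)) ×
    ((i i′ j j′ a a′ : Fin n) →
      toℕ i′ ≡ suc (toℕ i) → toℕ j′ ≡ suc (toℕ j) → toℕ a′ ≡ suc (toℕ a) →
      entry L₂ i j ≡ a′ → entry L₂ i j′ ≡ a → entry L₂ i′ j ≡ a → entry L₂ i′ j′ ≡ a′ →
      entry L₁ i j ≡ a → entry L₁ i j′ ≡ a′ → entry L₁ i′ j ≡ a′ → entry L₁ i′ j′ ≡ a →
      (∀ r c → (r ≢ i × r ≢ i′) ⊎ (c ≢ j × c ≢ j′) → entry L₁ r c ≡ entry L₂ r c) →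
      Covers L₂ L₁)
mainTheorem14 n L₁ L₂ =
  SumOf-posTBlock⇔SumOf-contig ,
  λ i i′ j j′ a a′ i′≡1+i j′≡1+j a′≡1+a L₂ij L₂ij′ L₂i′j L₂i′j′ L₁ij L₁ij′ L₁i′j L₁i′j′ elsewhere →
    let difference = intercalate-difference L₁ L₂
          (<⇒≢ (adjacent⇒< i′≡1+i)) (<⇒≢ (adjacent⇒< j′≡1+j))
          L₂ij L₂ij′ L₂i′j L₂i′j′ L₁ij L₁ij′ L₁i′j L₁i′j′ elsewhere
    in Φ≡-1⇒Covers L₁ L₂
         (SumOf-resp-≈H difference (SumOf-single (contig⇒posTBlock (δ⊗δ⊗δ-contig i′≡1+i j′≡1+j a′≡1+a))))
         (trans (⟪⟫-congˡ difference) (Φ-δ⊗δ⊗δ i i′ j j′ a a′ i′≡1+i j′≡1+j a′≡1+a))
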